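{- The BBC algebra $\mathfrak B=(\Lambda,\Pi,\perp\!\!\!\perp)$ is a coherent realizability algebra. In particular: for every stack $\pi$, every term $\xi$ and every stack $\varpi$ one has $\mathsf k_\pi\star\xi\cdot\varpi\succ\xi\star\pi$; and for every closed term $\theta\in\mathrm{PL}$ one has $\theta\star\pi_0\notin\perp\!\!\!\perp$.
   Context: Fix an integer $N\ge 0$. The set $\Lambda$ of terms is the smallest set containing the constants $\mathsf B,\mathsf C,\mathsf I,\mathsf K,\mathsf W$ (Curry's combinators), $\mathsf{cc}$ (Felleisen–Griffin instruction), $\mathsf A$ (abort), and the "variables" $\mathsf p,\mathsf q_0,\dots,\mathsf q_N$, closed under application ($\xi,\eta\in\Lambda\Rightarrow(\xi)\eta\in\Lambda$), and such that to every sequence $(\xi_i)_{i\in\mathbb N}$ of closed terms (terms with no occurrence of $\mathsf p,\mathsf q_0,\dots,\mathsf q_N$) is associated, injectively and in a well-founded way, a new constant $\bigwedge_i\xi_i$. Each term is a finite string of constants and parentheses; $(\xi_1)\xi_2\dots\xi_n$ abbreviates left-associated application. A stack is a finite sequence $t_0\cdot\ldots\cdot t_{n-1}\cdot\pi_0$ of terms ending with the symbol $\pi_0$ (the empty stack); $\Pi$ is the set of stacks; a process is a pair $\xi\star\pi\in\Lambda\times\Pi$. For a stack $\pi$ the continuation $\mathsf k_\pi$ is defined by $\mathsf k_{\pi_0}=\mathsf A$, $\mathsf k_{t\cdot\pi}=(\ell_t)\mathsf k_\pi$ where $\ell_t=((\mathsf C)(\mathsf B)\mathsf C\mathsf B)t$.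 Integers: $\underline 0=(\mathsf K)\mathsf I$, $\underline{n+1}=(\sigma)\underline n$ with $\sigma=(\mathsf B\mathsf W)(\mathsf C)(\mathsf B)\mathsf B\mathsf B$. Execution $\succ$ is the least preorder on processes such that: (1) $(\xi)\eta\star\pi\succ\xi\star\eta\cdot\pi$; (2) $\mathsf B\star\xi\cdot\eta\cdot\zeta\cdot\pi\succ\xi\star(\eta)\zeta\cdot\pi$; (3) $\mathsf C\star\xi\cdot\eta\cdot\zeta\cdot\pi\succ\xi\star\zeta\cdot\eta\cdot\pi$; (4) $\mathsf I\star\xi\cdot\pi\succ\xi\star\pi$; (5) $\mathsf K\star\xi\cdot\eta\cdot\pi\succ\xi\star\pi$; (6) $\mathsf W\star\xi\cdot\eta\cdot\pi\succ\xi\star\eta\cdot\eta\cdot\pi$; (7) $\mathsf{cc}\star\xi\cdot\pi\succ\xi\star\mathsf k_\pi\cdot\pi$; (8) $\mathsf A\star\xi\cdot\pi\succ\xi\star\pi_0$; (9) $\bigwedge_i\xi_i\star\underline n\cdot\pi\succ\xi_n\star\pi$. The pole is $\perp\!\!\!\perp=\{\xi\star\pi:\exists\varpi\in\Pi,\ \xi\star\pi\succ\mathsf p\star\varpi\}$. $\mathrm{PL}$ denotes the set of closed terms (the proof-like terms). A realizability algebra (in Krivine's sense) consists of terms, stacks, the operations above and a set $\perp\!\!\!\perp$ of processes closed under anti-execution, such that rules (1)–(7) hold with the continuation satisfying $\mathsf k_\pi\star\xi\cdot\varpi\succ\xi\star\pi$; it is coherent if for every proof-like term $\theta$ there is a stack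 $\pi$ with $\theta\star\pi\notin\perp\!\!\!\perp$. -}

module Defs where

open import Data.Nat using (ℕ; zero; suc)
open import Data.Fin using (Fin)
open import Data.Bool using (Bool; true; false; _∧_; T)
open import Data.List using (List; []; _∷_)
open import Data.Product using (_×_; _,_; ∃)
open import Relation.Nullary using (¬_)
open import Relation.Binary.Construct.Closure.ReflexiveTransitive using (Star)

module BBC (N : ℕ) where

  -- The constant ⋀ is attached to every sequence of *closed*
  -- terms; closedness is defined simultaneously (induction-recursion).
  -- Injectivity and well-foundedness of ⋀ are automatic for constructors
  -- of an inductive type.
  mutual
    data Λ : Set where
      𝐁 𝐂 𝐈 𝐊 𝐖 cc 𝐀 : Λ
      𝐩 : Λ
      𝐪 : Fin (suc N) → Λ
      app : Λ → Λ → Λ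
      ⋀ : (ξ : ℕ → Λ) → (∀ i → T (closed (ξ i))) → Λ

    closed : Λ → Bool
    closed 𝐁 = true
    closed 𝐂 = true
    closed 𝐈 = true
    closed 𝐊 = true
    closed 𝐖 = true
    closed cc = true
    closed 𝐀 = true
    closed 𝐩 = false
    closed (𝐪 _) = false
    closed (app ξ η) = closed ξ ∧ closed η
    closed (⋀ _ _) = true

  PL : Λ → Set
  PL θ = T (closed θ)

  -- stacks: t₀ · … · t_{n-1} · π₀  ↦  t₀ ∷ … ∷ t_{n-1} ∷ []  (π₀ = [])
  Π : Set
  Π = List Λ

  π₀ : Π
  π₀ = []

  Process : Set
  Process = Λ × Π

  infix 4 _⋆_
  _⋆_ : Λ → Π → Process
  ξ ⋆ π = ξ , π

  -- ℓ_t = ((C)(B)C B) t, where (C)(B)C B = (C)(((B)C)B)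
  ℓ : Λ → Λ
  ℓ t = app (app 𝐂 (app (app 𝐁 𝐂) 𝐁)) t

  k : Π → Λ
  k [] = 𝐀
  k (t ∷ π) = app (ℓ t) (k π)

  -- σ = (BW)(C)(B)B B = ((B)W)((C)(((B)B)B))
  σ : Λ
  σ = app (app 𝐁 𝐖) (app 𝐂 (app (app 𝐁 𝐁) 𝐁))

  num : ℕ → Λ
  num zero = app 𝐊 𝐈
  num (suc n) = app σ (num n)

  infix 3 _⟶_
  data _⟶_ : Process → Process → Set where
    push : ∀ {ξ η π} → app ξ η ⋆ π ⟶ ξ ⋆ η ∷ π
    rB : ∀ {ξ η ζ π} → 𝐁 ⋆ ξ ∷ η ∷ ζ ∷ π ⟶ ξ ⋆ app η ζ ∷ π
    rC : ∀ {ξ η ζ π} → 𝐂 ⋆ ξ ∷ η ∷ ζ ∷ π ⟶ ξ ⋆ ζ ∷ η ∷ π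
    rI : ∀ {ξ π} → 𝐈 ⋆ ξ ∷ π ⟶ ξ ⋆ π
    rK : ∀ {ξ η π} → 𝐊 ⋆ ξ ∷ η ∷ π ⟶ ξ ⋆ π
    rW : ∀ {ξ η π} → 𝐖 ⋆ ξ ∷ η ∷ π ⟶ ξ ⋆ η ∷ η ∷ π
    rcc : ∀ {ξ π} → cc ⋆ ξ ∷ π ⟶ ξ ⋆ k π ∷ π
    rA : ∀ {ξ π} → 𝐀 ⋆ ξ ∷ π ⟶ ξ ⋆ π₀
    r⋀ : ∀ {ξ c n π} → ⋀ ξ c ⋆ num n ∷ π ⟶ ξ n ⋆ π

  infix 3 _≻_
  _≻_ : Process → Process → Set
  _≻_ = Star _⟶_

  ⊥⊥ : Process → Set
  ⊥⊥ P = ∃ λ (ϖ : Π) → P ≻ (𝐩 ⋆ ϖ)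

-- * The pole is closed under anti-execution because execution ≻ is
--   transitive: a run P ≻ P′ composed with a run P′ ≻ p ⋆ ϖ is a run P ≻ p ⋆ ϖ.
-- * The continuation law k_π ⋆ ξ · ϖ ≻ ξ ⋆ π goes by induction on π: the
--   combinator ℓ_t turns k_{t·π} ⋆ ξ · ϖ into k_π ⋆ (ξ)t · ϖ, and at the
--   end A discards ϖ and the accumulated applications are pushed back.
-- * Coherence: call a process closed when its term and all terms of its stack
--   are proof-like.  Every rule (1)–(9) maps closed processes to closed ones
--   (for cc because continuations of closed stacks are closed, for ⋀ because
--   ⋀ only takes closed terms), hence so does ≻.  Since p is not closed, a
--   closed process never reaches p, so θ ⋆ π₀ ∉ ⊥⊥ for every θ ∈ PL.
module Submission where

open import Defs
open import Data.Nat using (ℕ)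
open import Data.List using ([]; _∷_)
open import Data.List.Relation.Unary.All using (All; []; _∷_)
open import Data.Product using (_×_; ∃; _,_)
open import Data.Bool.Properties using (T-∧)
open import Function.Bundles using (Equivalence)
open import Relation.Nullary using (¬_)
open import Relation.Binary.Construct.Closure.ReflexiveTransitive using (ε; _◅_; _◅◅_)

module Properties (N : ℕ) where
  open BBC N
  open Equivalence

  ⊥⊥-anti-execution : ∀ (P P′ : Process) → P ≻ P′ → ⊥⊥ P′ → ⊥⊥ P
  ⊥⊥-anti-execution P P′ P≻P′ (ϖ , P′≻p) = ϖ , (P≻P′ ◅◅ P′≻p)

  ℓ-step : ∀ (t κ ξ : Λ) (ϖ : Π) → (app (ℓ t) κ ⋆ ξ ∷ ϖ) ≻ (κ ⋆ app ξ t ∷ ϖ)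
  ℓ-step t κ ξ ϖ =
    push ◅ push ◅ push ◅ rC ◅ push ◅ push ◅ rB ◅ rC ◅ push ◅ rB ◅ ε

  continuation : ∀ (π : Π) (ξ : Λ) (ϖ : Π) → (k π ⋆ ξ ∷ ϖ) ≻ (ξ ⋆ π)
  continuation []      ξ ϖ = rA ◅ ε
  continuation (t ∷ π) ξ ϖ =
    ℓ-step t (k π) ξ ϖ ◅◅ continuation π (app ξ t) ϖ ◅◅ push ◅ ε

  ClosedProcess : Process → Set
  ClosedProcess (ξ , π) = PL ξ × All PL π

  -- The continuation of a stack of proof-like terms is proof-like
  -- (ℓ_t is closed exactly when t is).
  k-closed : ∀ (π : Π) → All PL π → PL (k π)
  k-closed []      []         = _
  k-closed (t ∷ π) (t∈PL ∷ π∈PL) = from T-∧ (t∈PL , k-closed π π∈PL)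

  step-closed : ∀ {P Q : Process} → P ⟶ Q → ClosedProcess P → ClosedProcess Q
  step-closed push                 (ξη , π)            = let ξ , η = to T-∧ ξη in ξ , η ∷ π
  step-closed rB                   (_ , ξ ∷ η ∷ ζ ∷ π) = ξ , from T-∧ (η , ζ) ∷ π
  step-closed rC                   (_ , ξ ∷ η ∷ ζ ∷ π) = ξ , ζ ∷ η ∷ π
  step-closed rI                   (_ , ξ ∷ π)         = ξ , π
  step-closed rK                   (_ , ξ ∷ _ ∷ π)     = ξ , π
  step-closed rW                   (_ , ξ ∷ η ∷ π)     = ξ , η ∷ η ∷ π
  step-closed (rcc {π = π})        (_ , ξ ∷ π∈PL)      = ξ , k-closed π π∈PL ∷ π∈PL
  step-closed rA                   (_ , ξ ∷ _)         = ξ , []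
  step-closed (r⋀ {c = c} {n = n}) (_ , _ ∷ π)         = c n , π

  execution-closed : ∀ {P Q : Process} → P ≻ Q → ClosedProcess P → ClosedProcess Q
  execution-closed ε         closed = closed
  execution-closed (s ◅ P≻Q) closed = execution-closed P≻Q (step-closed s closed)

  -- A closed process never reaches the variable p, so it is outside the pole.
  closed-∉⊥⊥ : ∀ (P : Process) → ClosedProcess P → ¬ ⊥⊥ P
  closed-∉⊥⊥ P closed (ϖ , P≻p) with execution-closed P≻p closed
  ... | () , _

  proof-like-∉⊥⊥ : ∀ (θ : Λ) → PL θ → ¬ ⊥⊥ (θ ⋆ π₀)
  proof-like-∉⊥⊥ θ θ∈PL = closed-∉⊥⊥ (θ ⋆ π₀) (θ∈PL , [])

lemma1 : (N : ℕ) → let open BBC N in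
    (∀ (P P′ : Process) → P ≻ P′ → ⊥⊥ P′ → ⊥⊥ P)
    × (∀ (π : Π) (ξ : Λ) (ϖ : Π) → (k π ⋆ ξ ∷ ϖ) ≻ (ξ ⋆ π))
    × (∀ (θ : Λ) → PL θ → ∃ λ (π : Π) → ¬ ⊥⊥ (θ ⋆ π))
    × (∀ (θ : Λ) → PL θ → ¬ ⊥⊥ (θ ⋆ π₀))
lemma1 N = ⊥⊥-anti-execution
         , continuation
         , (λ θ θ∈PL → π₀ , proof-like-∉⊥⊥ θ θ∈PL)
         , proof-like-∉⊥⊥
  where open BBC N using (π₀)
        open Properties N
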